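{- Let $t\geq 3$ be an integer and let $\mathcal{F}$ be a set of integers such that: (a) $|\mathcal{F}|=t+1$; (b) $\mathcal{F}\subset\{ -(t-1),\dots,-1\}\cup\{1,\dots,t-1\}\cup\{t+1\}$; (c) $\{1,-(t-1),t+1\}\subset\mathcal{F}$; (d) there exists $i\in\mathcal{F}\setminus\{1,-(t-1),t+1\}$ with $i<0$; (e) if $i>0$ and $i\in\mathcal{F}\setminus\{1,-(t-1),t+1\}$ then $i-t\notin\mathcal{F}$. Then every integer $\gamma$ with $1\le\gamma\le t-1$ can be written as $\gamma=j-i$ with $i,j\in\mathcal{F}$. -}

module Defs where

-- The elements of F other than t + 1 lie in the pairs {r, r − t}, 1 ≤ r ≤ t − 1.
-- The pair {1, 1 − t} is contained in F and, by (e), every other pair contains at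
-- most one element of F. So the map sending x > 0 to x and x < 0 to x + t, except
-- that 1 is sent to the free value t, is injective on F with values in {1, …, t + 1};
-- since |F| = t + 1 it is onto, hence every pair {r, r − t} meets F. Then γ + 1 or
-- γ + 1 − t lies in F, giving γ = (γ + 1) − 1 or γ = (γ + 1 − t) − (1 − t); for
-- γ = t − 1 the pair of 2 gives t − 1 = (t + 1) − 2 = 1 − (2 − t).
module Submission where

open import Defs
open import Data.Nat using (ℕ; suc; _≥_)
open import Data.Integer using (ℤ; +_; -_; _-_; _+_; _≤_; _<_; 0ℤ; 1ℤ)
open import Data.List using (List; length)
open import Data.List.Membership.Propositional using (_∈_; _∉_)
open import Data.List.Relation.Unary.Unique.Propositional using (Unique)
open import Data.Product using (Σ; _×_; _,_; ∃₂)
open import Data.Sum using (_⊎_)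
open import Relation.Binary.PropositionalEquality using (_≡_; _≢_)

open import Level using (_⊔_)
open import Function using (_∘_)
import Data.Nat as ℕ
import Data.Nat.Properties as ℕ
open import Data.Integer using (-[1+_]; ∣_∣; +≤+; -≤+; +<+)
import Data.Integer.Properties as ℤ
open import Data.Integer.Tactic.RingSolver using (solve-∀)
open import Data.List using ([]; _∷_; filter; applyUpTo)
open import Data.List.Properties using (filter-notAll; length-applyUpTo)
open import Data.List.Relation.Unary.Any as Any using (here; there)
import Data.List.Relation.Unary.All as All
open import Data.List.Relation.Unary.AllPairs using (_∷_)
open import Data.List.Membership.Propositional.Properties using (∈-filter⁺; ∈-applyUpTo⁺)
open import Data.List.Membership.DecPropositional ℤ._≟_ using (_∈?_)
open import Data.Sum using (inj₁; inj₂)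
open import Data.Empty using (⊥-elim)
open import Relation.Nullary using (yes; no; ¬?; contradiction)
open import Relation.Binary.Definitions using (DecidableEquality)
open import Relation.Binary.PropositionalEquality using (refl; sym; trans; cong; subst)
open import Algebra.Bundles using (AbelianGroup)
open import Algebra.Properties.Group (AbelianGroup.group ℤ.+-0-abelianGroup) using (∙-cancelʳ)

InjectiveOn : ∀ {a b} {A : Set a} {B : Set b} → (A → B) → List A → Set (a ⊔ b)
InjectiveOn f xs = ∀ {x y} → x ∈ xs → y ∈ xs → f x ≡ f y → x ≡ y

module _ {a b} {A : Set a} {B : Set b} (_≟_ : DecidableEquality B) {f : A → B} where

  injectiveOn⇒length≤ : ∀ {xs ys} → Unique xs → InjectiveOn f xs →
    (∀ {x} → x ∈ xs → f x ∈ ys) → length xs ℕ.≤ length ys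
  injectiveOn∧missed⇒length< : ∀ {xs ys y} → Unique xs → InjectiveOn f xs →
    (∀ {x} → x ∈ xs → f x ∈ ys) → y ∈ ys → (∀ {x} → x ∈ xs → f x ≢ y) →
    length xs ℕ.< length ys

  injectiveOn⇒length≤ {[]} _ _ _ = ℕ.z≤n
  injectiveOn⇒length≤ {x ∷ xs} (x∉xs ∷ xs!) inj into =
    injectiveOn∧missed⇒length< xs! (λ p q → inj (there p) (there q)) (into ∘ there) (into (here refl))
      (λ p fy≡fx → All.lookup x∉xs p (sym (inj (there p) (here refl) fy≡fx)))

  injectiveOn∧missed⇒length< {xs} {ys} {y} xs! inj into y∈ys missed = begin-strict
    length xs              ≤⟨ injectiveOn⇒length≤ xs! inj (λ p → ∈-filter⁺ ≢y? (into p) (missed p)) ⟩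
    length (filter ≢y? ys) <⟨ filter-notAll ≢y? ys (Any.map (λ y≡z z≢y → z≢y (sym y≡z)) y∈ys) ⟩
    length ys              ∎
    where
    open ℕ.≤-Reasoning
    ≢y? = λ z → ¬? (z ≟ y)

i+j-j≡i : ∀ i j → i + j - j ≡ i
i+j-j≡i = solve-∀

i+1-i≡1 : ∀ i → i + 1ℤ - i ≡ 1ℤ
i+1-i≡1 = solve-∀

-[i-1]+i≡1 : ∀ i → - (i - 1ℤ) + i ≡ 1ℤ
-[i-1]+i≡1 = solve-∀

i-1≡i+1-2 : ∀ i → i - 1ℤ ≡ i + 1ℤ - + 2
i-1≡i+1-2 = solve-∀

i-1≡1-[2-i] : ∀ i → i - 1ℤ ≡ 1ℤ - (+ 2 - i)
i-1≡1-[2-i] = solve-∀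

i≡1+i-1 : ∀ i → i ≡ 1ℤ + i - 1ℤ
i≡1+i-1 = solve-∀

i≡1+i-j-[1-j] : ∀ i j → i ≡ 1ℤ + i - j - (- (j - 1ℤ))
i≡1+i-j-[1-j] = solve-∀

module PairCovering (t : ℕ) (1≤t : 1 ℕ.≤ t) (F : List ℤ) (F! : Unique F) (|F|≡1+t : length F ≡ suc t)
  (F-range : ∀ x → x ∈ F → ((- (+ t - 1ℤ) ≤ x × x ≤ - 1ℤ) ⊎ (1ℤ ≤ x × x ≤ + t - 1ℤ) ⊎ x ≡ + t + 1ℤ))
  (F-shift-free : ∀ i → i ∈ F → i ≢ 1ℤ → i ≢ - (+ t - 1ℤ) → i ≢ + t + 1ℤ → 0ℤ < i → (i - + t) ∉ F)
  where

  0∉F : 0ℤ ∉ F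
  0∉F 0∈F with F-range 0ℤ 0∈F
  ... | inj₂ (inj₁ (+≤+ () , _))
  ... | inj₂ (inj₂ 0≡t+1) = ℕ.0≢1+n (trans (cong ∣_∣ 0≡t+1) (ℕ.+-comm t 1))

  t∉F : + t ∉ F
  t∉F t∈F with F-range (+ t) t∈F
  ... | inj₂ (inj₁ (_ , t≤t-1)) = ℤ.<-irrefl refl (ℤ.i≤pred[j]⇒i<j t≤t-1)
  ... | inj₂ (inj₂ t≡t+1) = ℕ.m+1+n≢m t (sym (cong ∣_∣ t≡t+1))

  t≤t+1 : + t ≤ + t + 1ℤ
  t≤t+1 = ℤ.i≤i+j (+ t) 1ℤ

  x∈F⇒x≤t+1 : ∀ {x} → x ∈ F → x ≤ + t + 1ℤ
  x∈F⇒x≤t+1 x∈F with F-range _ x∈F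
  ... | inj₁ (_ , x≤-1) = ℤ.≤-trans x≤-1 (ℤ.≤-trans -≤+ t≤t+1)
  ... | inj₂ (inj₁ (_ , x≤t-1)) = ℤ.≤-trans (ℤ.<⇒≤ (ℤ.i≤pred[j]⇒i<j x≤t-1)) t≤t+1
  ... | inj₂ (inj₂ refl) = ℤ.≤-refl

  1≤negative+t : ∀ {n} → -[1+ n ] ∈ F → 1ℤ ≤ -[1+ n ] + + t
  1≤negative+t x∈F with F-range _ x∈F
  ... | inj₁ (1-t≤x , _) = subst (_≤ -[1+ _ ] + + t) (-[i-1]+i≡1 (+ t)) (ℤ.+-monoˡ-≤ (+ t) 1-t≤x)
  ... | inj₂ (inj₁ (() , _))
  ... | inj₂ (inj₂ ())

  slot : ℤ → ℤ
  slot (+ 1) = + t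
  slot (+ n) = + n
  slot -[1+ n ] = -[1+ n ] + + t

  slots : List ℤ
  slots = applyUpTo (λ i → + suc i) (suc t)

  ∈-slots : ∀ {v} → 1ℤ ≤ v → v ≤ + t + 1ℤ → v ∈ slots
  ∈-slots {+ 0} (+≤+ ()) _
  ∈-slots {+ suc i} _ (+≤+ i<t+1) =
    ∈-applyUpTo⁺ (λ i → + suc i) (subst (suc i ℕ.≤_) (ℕ.+-comm t 1) i<t+1)

  slot∈slots : ∀ {x} → x ∈ F → slot x ∈ slots
  slot∈slots {+ 0} 0∈F = contradiction 0∈F 0∉F
  slot∈slots {+ 1} _ = ∈-slots (+≤+ 1≤t) t≤t+1
  slot∈slots {+ suc (suc n)} x∈F = ∈-slots (+≤+ (ℕ.s≤s ℕ.z≤n)) (x∈F⇒x≤t+1 x∈F)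
  slot∈slots { -[1+ n ]} x∈F =
    ∈-slots (1≤negative+t x∈F) (ℤ.≤-trans (ℤ.+-monoˡ-≤ (+ t) -≤+) t≤t+1)

  -[t-1]≤0 : - (+ t - 1ℤ) ≤ 0ℤ
  -[t-1]≤0 = ℤ.neg-mono-≤ (ℤ.i≤j⇒0≤j-i (+≤+ 1≤t))

  positive≢negative+t : ∀ {m n} → + suc (suc m) ∈ F → -[1+ n ] ∈ F → + suc (suc m) ≢ -[1+ n ] + + t
  positive≢negative+t {m} {n} a∈F x∈F a≡x+t =
    F-shift-free a a∈F (λ ()) a≢1-t a≢t+1 (+<+ (ℕ.s≤s ℕ.z≤n)) (subst (_∈ F) (sym a-t≡x) x∈F)
    where
    a = + suc (suc m)
    a-t≡x : a - + t ≡ -[1+ n ]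
    a-t≡x = trans (cong (_- + t) a≡x+t) (i+j-j≡i -[1+ n ] (+ t))
    a≢1-t : a ≢ - (+ t - 1ℤ)
    a≢1-t a≡1-t = ℤ.<⇒≱ (+<+ (ℕ.s≤s ℕ.z≤n)) (subst (_≤ 0ℤ) (sym a≡1-t) -[t-1]≤0)
    a≢t+1 : a ≢ + t + 1ℤ
    a≢t+1 a≡t+1 with trans (sym a-t≡x) (trans (cong (_- + t) a≡t+1) (i+1-i≡1 (+ t)))
    ... | ()

  slot-injective : InjectiveOn slot F
  slot-injective {+ 0} 0∈F _ _ = contradiction 0∈F 0∉F
  slot-injective {_} {+ 0} _ 0∈F _ = contradiction 0∈F 0∉F
  slot-injective {+ 1} {+ 1} _ _ _ = refl
  slot-injective {+ 1} {+ suc (suc n)} _ y∈F t≡y = contradiction (subst (_∈ F) (sym t≡y) y∈F) t∉F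
  slot-injective {+ suc (suc m)} {+ 1} x∈F _ x≡t = contradiction (subst (_∈ F) x≡t x∈F) t∉F
  slot-injective {+ 1} { -[1+ n ]} _ _ t≡y+t with ∙-cancelʳ (+ t) 0ℤ -[1+ n ] t≡y+t
  ... | ()
  slot-injective { -[1+ m ]} {+ 1} _ _ x+t≡t with ∙-cancelʳ (+ t) -[1+ m ] 0ℤ x+t≡t
  ... | ()
  slot-injective {+ suc (suc m)} {+ suc (suc n)} _ _ x≡y = x≡y
  slot-injective {+ suc (suc m)} { -[1+ n ]} x∈F y∈F x≡y+t =
    contradiction x≡y+t (positive≢negative+t x∈F y∈F)
  slot-injective { -[1+ m ]} {+ suc (suc n)} x∈F y∈F x+t≡y =
    contradiction (sym x+t≡y) (positive≢negative+t y∈F x∈F)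
  slot-injective { -[1+ m ]} { -[1+ n ]} _ _ x+t≡y+t = ∙-cancelʳ (+ t) _ _ x+t≡y+t

  slot≢unhit : ∀ {r x} → r ≤ + t - 1ℤ → r ∉ F → r - + t ∉ F → x ∈ F → slot x ≢ r
  slot≢unhit {x = + 0} _ _ _ 0∈F = contradiction 0∈F 0∉F
  slot≢unhit {x = + 1} r≤t-1 _ _ _ t≡r = ℤ.<-irrefl (sym t≡r) (ℤ.i≤pred[j]⇒i<j r≤t-1)
  slot≢unhit {x = + suc (suc n)} _ r∉F _ x∈F x≡r = r∉F (subst (_∈ F) x≡r x∈F)
  slot≢unhit {x = -[1+ n ]} _ _ r-t∉F x∈F x+t≡r =
    r-t∉F (subst (_∈ F) (trans (sym (i+j-j≡i -[1+ n ] (+ t))) (cong (_- + t) x+t≡r)) x∈F)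

  pair-hit : ∀ r → 1ℤ ≤ r → r ≤ + t - 1ℤ → r ∈ F ⊎ r - + t ∈ F
  pair-hit r 1≤r r≤t-1 with r ∈? F | r - + t ∈? F
  ... | yes r∈F | _ = inj₁ r∈F
  ... | no _ | yes r-t∈F = inj₂ r-t∈F
  ... | no r∉F | no r-t∉F = ⊥-elim (ℕ.<-irrefl |F|≡|slots|
          (injectiveOn∧missed⇒length< ℤ._≟_ F! slot-injective slot∈slots r∈slots (slot≢unhit r≤t-1 r∉F r-t∉F)))
    where
    |F|≡|slots| : length F ≡ length slots
    |F|≡|slots| = trans |F|≡1+t (sym (length-applyUpTo (λ i → + suc i) (suc t)))
    r∈slots : r ∈ slots
    r∈slots = ∈-slots 1≤r (ℤ.≤-trans (ℤ.<⇒≤ (ℤ.i≤pred[j]⇒i<j r≤t-1)) t≤t+1)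

  differences-cover : 2 ℕ.< t → 1ℤ ∈ F → - (+ t - 1ℤ) ∈ F → + t + 1ℤ ∈ F →
    ∀ γ → 1ℤ ≤ γ → γ ≤ + t - 1ℤ → ∃₂ λ i j → i ∈ F × j ∈ F × γ ≡ j - i
  differences-cover 2<t 1∈F 1-t∈F t+1∈F γ 1≤γ γ≤t-1 with γ ℤ.≟ + t - 1ℤ
  ... | yes refl with pair-hit (+ 2) (+≤+ (ℕ.s≤s ℕ.z≤n)) (ℤ.i<j⇒i≤pred[j] (+<+ 2<t))
  ...   | inj₁ 2∈F   = + 2 , + t + 1ℤ , 2∈F , t+1∈F , i-1≡i+1-2 (+ t)
  ...   | inj₂ 2-t∈F = + 2 - + t , 1ℤ , 2-t∈F , 1∈F , i-1≡1-[2-i] (+ t)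
  differences-cover 2<t 1∈F 1-t∈F t+1∈F γ 1≤γ γ≤t-1 | no γ≢t-1
    with pair-hit (1ℤ + γ) (ℤ.≤-trans 1≤γ (ℤ.i≤suc[i] γ)) (ℤ.i<j⇒suc[i]≤j (ℤ.≤∧≢⇒< γ≤t-1 γ≢t-1))
  ... | inj₁ 1+γ∈F   = 1ℤ , (1ℤ + γ) , 1∈F , 1+γ∈F , i≡1+i-1 γ
  ... | inj₂ 1+γ-t∈F = - (+ t - 1ℤ) , (1ℤ + γ) - + t , 1-t∈F , 1+γ-t∈F , i≡1+i-j-[1-j] γ (+ t)

lemma7 : (t : ℕ) → t ≥ 3 → (F : List ℤ) → Unique F →
    length F ≡ suc t →
    (∀ x → x ∈ F → ((- (+ t - 1ℤ) ≤ x × x ≤ - 1ℤ) ⊎ (1ℤ ≤ x × x ≤ + t - 1ℤ) ⊎ x ≡ + t + 1ℤ)) →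
    1ℤ ∈ F → - (+ t - 1ℤ) ∈ F → (+ t + 1ℤ) ∈ F →
    Σ ℤ (λ i → i ∈ F × i ≢ 1ℤ × i ≢ - (+ t - 1ℤ) × i ≢ + t + 1ℤ × i < 0ℤ) →
    (∀ i → i ∈ F → i ≢ 1ℤ → i ≢ - (+ t - 1ℤ) → i ≢ + t + 1ℤ → 0ℤ < i → (i - + t) ∉ F) →
    ∀ (γ : ℤ) → 1ℤ ≤ γ → γ ≤ + t - 1ℤ →
    ∃₂ λ i j → i ∈ F × j ∈ F × γ ≡ j - i
lemma7 t t≥3 F F! |F|≡1+t F-range 1∈F 1-t∈F t+1∈F _ F-shift-free =
  PairCovering.differences-cover t (ℕ.≤-trans (ℕ.s≤s ℕ.z≤n) t≥3) F F! |F|≡1+t F-range F-shift-free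
    t≥3 1∈F 1-t∈F t+1∈F
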